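{- Let $\mathcal{S}$ be a progressing and connected set of rules, let $p$ be a predicate with arity $\#p$, let $t_1,\ldots,t_{\#p}$ be terms, and let $(\mathfrak{s},\mathfrak{h})$ be a structure such that $(\mathfrak{s},\mathfrak{h}) \models_\mathcal{S} p(t_1,\ldots,t_{\#p})$. Then there exists an unfolding tree $u$ of $p(t_1,\ldots,t_{\#p})$ (with respect to $\mathcal{S}$) such that $(\mathfrak{s},\mathfrak{h}) \models \chi(u)$, where $\chi(u)$ is the characteristic formula of $u$, and there exists an embedding of $u$ into $\mathfrak{h}$.
   Context: Syntax. Fix an integer $\kappa \ge 1$ (number of record fields). Let $\mathsf{Var}$ be an infinite countable set of variables, $\mathsf{Pred}$ an infinite countable set of predicate symbols, each $p$ with an arity $\#p \ge 1$, and $\mathsf{nil}$ a constant. Terms are elements of $\mathsf{Var}\cup\{\mathsf{nil}\}$. Formulas are generated by $$\phi ::= t_0 \mapsto (t_1,\ldots,t_\kappa) \mid p(t_1,\ldots,t_{\#p}) \mid t_1 \approx t_2 \mid t_1 \not\approx t_2 \mid \phi_1 * \phi_2 \mid \exists x.\,\phi_1 .$$ Atoms $t_0\mapsto(\ldots)$ are points-to atoms, $p(\ldots)$ predicate atoms. A formula is predicate-free if no predicate atom occurs in it. $\mathrm{fv}(\phi)$ denotes the free variables. Semantics. Fix a countably infinite set $\mathsf{Loc}$ of locations with a designated $\mathit{nil}\in\mathsf{Loc}$. A structure is a pair $(\mathfrak{s},\mathfrak{h})$ with a store $\mathfrak{s}$ (a total map from terms to $\mathsf{Loc}$ with $\mathfrak{s}(\mathsf{nil})=\mathit{nil}$)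 and a heap $\mathfrak{h}$ (a finite partial map $\mathsf{Loc} \rightharpoonup \mathsf{Loc}^\kappa$ with $\mathit{nil}\notin\mathrm{dom}(\mathfrak{h})$). For predicate-free formulas: $(\mathfrak{s},\mathfrak{h})\models t_1\approx t_2$ iff $\mathfrak{h}=\emptyset$ and $\mathfrak{s}(t_1)=\mathfrak{s}(t_2)$; $(\mathfrak{s},\mathfrak{h})\models t_1\not\approx t_2$ iff $\mathfrak{h}=\emptyset$ and $\mathfrak{s}(t_1)\neq\mathfrak{s}(t_2)$; $(\mathfrak{s},\mathfrak{h})\models t_0\mapsto(t_1,\ldots,t_\kappa)$ iff $\mathrm{dom}(\mathfrak{h})=\{\mathfrak{s}(t_0)\}$ and $\mathfrak{h}(\mathfrak{s}(t_0))=(\mathfrak{s}(t_1),\ldots,\mathfrak{s}(t_\kappa))$; $(\mathfrak{s},\mathfrak{h})\models\phi_1*\phi_2$ iff $\mathfrak{h}=\mathfrak{h}_1\uplus\mathfrak{h}_2$ for heaps with disjoint domains with $(\mathfrak{s},\mathfrak{h}_i)\models\phi_i$; $(\mathfrak{s},\mathfrak{h})\models\exists x.\phi$ iff $(\mathfrak{s}[x\leftarrow\ell],\mathfrak{h})\models\phi$ for some $\ell\in\mathsf{Loc}$. Rules. A set of rules $\mathcal{S}$ consists of rules $p(x_1,\ldots,x_{\#p}) \Leftarrow \rho$ with $\rho$ a formula and $\mathrm{fv}(\rho)\subseteq\{x_1,\ldots,x_{\#p}\}$. Trees. A tree $t$ has a finite nonempty prefix-closed set $\texttt{nodes}(t)\subseteq\mathbb{N}^*$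 such that $wi\in\texttt{nodes}(t)$ implies $wj\in\texttt{nodes}(t)$ for all $j<i$, and a labelling $w\mapsto t(w)$; the root is the empty word $\lambda$, the children of $w$ are the nodes $wi$; $t|_w$ denotes the subtree rooted at $w$. Unfolding trees. An unfolding tree of a predicate atom $p(t_1,\ldots,t_{\#p})$ is a tree $u$ where every node $w$ is labelled $u(w)=(q(s_1,\ldots,s_{\#q}),\psi)$ such that: (1) at the root, $q(s_1,\ldots,s_{\#q})=p(t_1,\ldots,t_{\#p})$; (2) $\psi=\rho[s_1/x_1,\ldots,s_{\#q}/x_{\#q}]$ for some rule $q(x_1,\ldots,x_{\#q})\Leftarrow\rho$ in $\mathcal{S}$; (3) there is a bijection between the occurrences of predicate atoms in $\psi$ and the children of $w$ such that if $r(v_1,\ldots,v_{\#r})$ is mapped to $wi$ then $u(wi)=(r(v_1,\ldots,v_{\#r}),\psi_i)$ for some $\psi_i$. The characteristic formula $\chi(u)$ is defined inductively: if $u(\lambda)=(p(\ldots),\psi)$ with $\psi=\exists y_1\ldots\exists y_n.\,\varphi * \mathop{\ast}_{i=1}^m q_i(\ldots)$, $\varphi$ predicate-free, then $\chi(u)=\exists y_1\ldots\exists y_n.\,\varphi*\mathop{\ast}_{i=1}^m\chi(u|_{i'})$, where $i'$ is the child to which the $i$-th atom is mapped. For a formula $\phi$, $(\mathfrak{s},\mathfrak{h})\models_\mathcal{S}\phi$ iff $(\mathfrak{s},\mathfrak{h})\models\psi$ for some formula $\psi$ obtained from $\phi$ by replacing each occurrence of a predicate atom $p(t_1,\ldots,t_{\#p})$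 by $\chi(u)$ for some unfolding tree $u$ of $p(t_1,\ldots,t_{\#p})$. Progressing/connected. $\mathcal{S}$ is progressing iff the body of every rule $p(x_1,\ldots,x_{\#p})\Leftarrow\rho$ has the form $\exists z_1\ldots\exists z_m.\, x_1\mapsto(y_1,\ldots,y_\kappa)*\psi$ where $\psi$ contains no points-to atom; it is moreover connected iff each predicate atom occurring in such $\psi$ has the form $q(y_i,u_1,\ldots,u_{\#q-1})$ for some $i\in\{1,\ldots,\kappa\}$. Embedding. Given a heap $\mathfrak{h}$ and a tree $t$, an embedding of $t$ into $\mathfrak{h}$ is a bijection $\Lambda:\texttt{nodes}(t)\to\mathrm{dom}(\mathfrak{h})$ such that for every node $wi\in\texttt{nodes}(t)$ ($i\in\mathbb{N}$), $\Lambda(wi)$ is one of the components of the tuple $\mathfrak{h}(\Lambda(w))$. -}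

module Defs where

open import Data.Nat using (ℕ; zero; suc; _+_; _≤_; _<_)
open import Data.Fin using (Fin; zero; suc; splitAt; _↑ˡ_; _↑ʳ_)
open import Data.Vec using (Vec; []; _∷_; lookup) renaming (map to vmap; head to vhead)
open import Data.List using (List)
open import Data.List.Relation.Unary.All using (All)
open import Data.List.Membership.Propositional using (_∈_)
open import Data.Maybe using (Maybe; just; nothing)
open import Data.Product using (Σ; ∃; _×_; _,_)
open import Data.Sum using (_⊎_; inj₁; inj₂; [_,_])
open import Data.Unit using (⊤; tt)
open import Data.Empty using (⊥)
open import Function using (_∘_)
open import Relation.Binary.PropositionalEquality using (_≡_; _≢_)

-- Predicate symbols are natural
-- numbers; predicate p has arity  # p = suc (ar p)  (so every arity is ≥ 1).
-- Variables are de Bruijn indices (ℕ); locations are ℕ with nil = 0.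
module SL (κ : ℕ) (ar : ℕ → ℕ) where

  #_ : ℕ → ℕ
  # p = suc (ar p)

  Loc : Set
  Loc = ℕ

  nilLoc : Loc
  nilLoc = 0

  data Term : Set where
    var : ℕ → Term
    nil : Term

  data Form : Set where
    pto : Term → Vec Term κ → Form
    pa  : (p : ℕ) → Vec Term (# p) → Form
    eq  : Term → Term → Form
    neq : Term → Term → Form
    _⋆_ : Form → Form → Form
    ex  : Form → Form                           -- ∃ (binds de Bruijn index 0)

  exs : ℕ → Form → Form
  exs zero    φ = φ
  exs (suc m) φ = ex (exs m φ)

  shiftT : ℕ → Term → Term
  shiftT d (var k) = var (d + k)
  shiftT d nil     = nil

  lift : (ℕ → Term) → ℕ → Term
  lift σ zero    = var zero
  lift σ (suc k) = shiftT 1 (σ k)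

  substT : (ℕ → Term) → Term → Term
  substT σ (var k) = σ k
  substT σ nil     = nil

  subst : (ℕ → Term) → Form → Form
  subst σ (pto t ts) = pto (substT σ t) (vmap (substT σ) ts)
  subst σ (pa p ts)  = pa p (vmap (substT σ) ts)
  subst σ (eq t u)   = eq (substT σ t) (substT σ u)
  subst σ (neq t u)  = neq (substT σ t) (substT σ u)
  subst σ (φ ⋆ ψ)    = subst σ φ ⋆ subst σ ψ
  subst σ (ex φ)     = ex (subst (lift σ) φ)

  -- the substitution [t₁/x₁,…,t_n/x_n]  (x_i is the free variable i-1)
  vecSub : ∀ {n} → Vec Term n → ℕ → Term
  vecSub []       k       = var k
  vecSub (t ∷ ts) zero    = t
  vecSub (t ∷ ts) (suc k) = vecSub ts k

  inst : ∀ {n} → Form → Vec Term n → Form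
  inst ρ ts = subst (vecSub ts) ρ

  Atom : Set
  Atom = Σ ℕ (λ q → Vec Term (# q))

  occ : Form → ℕ
  occ (pto _ _) = 0
  occ (pa _ _)  = 1
  occ (eq _ _)  = 0
  occ (neq _ _) = 0
  occ (φ ⋆ ψ)   = occ φ + occ ψ
  occ (ex φ)    = occ φ

  occAtom : (φ : Form) → Fin (occ φ) → Atom
  occAtom (pa p ts) _ = p , ts
  occAtom (φ ⋆ ψ) i   = [ occAtom φ , occAtom ψ ] (splitAt (occ φ) i)
  occAtom (ex φ) i    = occAtom φ i

  replace : (φ : Form) → (Fin (occ φ) → Form) → Form
  replace (pto t ts) f = pto t ts
  replace (pa p ts) f  = f zero
  replace (eq t u) f   = eq t u
  replace (neq t u) f  = neq t u
  replace (φ ⋆ ψ) f    = replace φ (λ i → f (i ↑ˡ occ ψ)) ⋆ replace ψ (λ i → f (occ φ ↑ʳ i))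
  replace (ex φ) f     = ex (replace φ f)

  record Rule : Set where
    constructor rule
    field
      head : ℕ       -- the predicate p ; its parameters are x_i = var (i-1)
      body : Form

  TermScoped : ℕ → ℕ → Term → Set
  TermScoped d n (var k) = k < d + n
  TermScoped d n nil     = ⊤

  AllV : ∀ {m} → (Term → Set) → Vec Term m → Set
  AllV P []       = ⊤
  AllV P (t ∷ ts) = P t × AllV P ts

  Scoped : ℕ → ℕ → Form → Set
  Scoped d n (pto t ts) = TermScoped d n t × AllV (TermScoped d n) ts
  Scoped d n (pa p ts)  = AllV (TermScoped d n) ts
  Scoped d n (eq t u)   = TermScoped d n t × TermScoped d n u
  Scoped d n (neq t u)  = TermScoped d n t × TermScoped d n u
  Scoped d n (φ ⋆ ψ)    = Scoped d n φ × Scoped d n ψ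
  Scoped d n (ex φ)     = Scoped (suc d) n φ

  WFRules : List Rule → Set
  WFRules S = All (λ r → Scoped 0 (# Rule.head r) (Rule.body r)) S

  NoPto : Form → Set
  NoPto (pto _ _) = ⊥
  NoPto (pa _ _)  = ⊤
  NoPto (eq _ _)  = ⊤
  NoPto (neq _ _) = ⊤
  NoPto (φ ⋆ ψ)   = NoPto φ × NoPto ψ
  NoPto (ex φ)    = NoPto φ

  AllPA : (ℕ → (q : ℕ) → Vec Term (# q) → Set) → ℕ → Form → Set
  AllPA P d (pto _ _) = ⊤
  AllPA P d (pa q ts) = P d q ts
  AllPA P d (eq _ _)  = ⊤
  AllPA P d (neq _ _) = ⊤
  AllPA P d (φ ⋆ ψ)   = AllPA P d φ × AllPA P d ψ
  AllPA P d (ex φ)    = AllPA P (suc d) φ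

  -- body = ∃z₁…∃z_m. x₁ ↦ (y₁,…,y_κ) * ψ , ψ without points-to atoms, and
  -- every predicate atom in ψ is q(y_i, …) for some i
  ProgConnRule : Rule → Set
  ProgConnRule r =
    Σ ℕ λ m → Σ (Vec Term κ) λ ys → Σ Form λ ψ →
      (Rule.body r ≡ exs m (pto (var m) ys ⋆ ψ)) × NoPto ψ ×
      AllPA (λ d q vs → Σ (Fin κ) λ i → vhead vs ≡ shiftT d (lookup ys i)) 0 ψ

  ProgressingConnected : List Rule → Set
  ProgressingConnected S = All ProgConnRule S

  Store : Set
  Store = ℕ → Loc

  Heap : Set
  Heap = Loc → Maybe (Vec Loc κ)

  IsHeap : Heap → Set
  IsHeap h = (h nilLoc ≡ nothing) × (Σ ℕ λ b → ∀ ℓ → b ≤ ℓ → h ℓ ≡ nothing)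

  ⟦_⟧ : Term → Store → Loc
  ⟦ var k ⟧ s = s k
  ⟦ nil ⟧   s = nilLoc

  _∷ₛ_ : Loc → Store → Store
  (ℓ ∷ₛ s) zero    = ℓ
  (ℓ ∷ₛ s) (suc k) = s k

  Emp : Heap → Set
  Emp h = ∀ ℓ → h ℓ ≡ nothing

  Split : Heap → Heap → Heap → Set
  Split h h₁ h₂ = ∀ ℓ → (h₁ ℓ ≡ nothing × h ℓ ≡ h₂ ℓ) ⊎ (h₂ ℓ ≡ nothing × h ℓ ≡ h₁ ℓ)

  -- (s , h) ⊨ φ   (predicate atoms are never satisfied: ⊨ is for predicate-free φ)
  Sat : Store → Heap → Form → Set
  Sat s h (pto t ts) = (h (⟦ t ⟧ s) ≡ just (vmap (λ u → ⟦ u ⟧ s) ts))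
                       × (∀ ℓ → ℓ ≢ ⟦ t ⟧ s → h ℓ ≡ nothing)
  Sat s h (pa _ _)   = ⊥
  Sat s h (eq t u)   = Emp h × ⟦ t ⟧ s ≡ ⟦ u ⟧ s
  Sat s h (neq t u)  = Emp h × ⟦ t ⟧ s ≢ ⟦ u ⟧ s
  Sat s h (φ ⋆ ψ)    = Σ Heap λ h₁ → Σ Heap λ h₂ → Split h h₁ h₂ × Sat s h₁ φ × Sat s h₂ ψ
  Sat s h (ex φ)     = Σ Loc λ ℓ → Sat (ℓ ∷ₛ s) h φ

  -- unfolding trees: a node is labelled (q(vs), ψ); it has n children, and
  -- π is the bijection from predicate-atom occurrences of ψ to children.

  data UTree : Set where
    node : (q : ℕ) (vs : Vec Term (# q)) (ψ : Form)
           (n : ℕ) (π : Fin (occ ψ) → Fin n) (ch : Fin n → UTree) → UTree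

  atomOf : UTree → Atom
  atomOf (node q vs _ _ _ _) = q , vs

  Bij : ∀ {a b} → (Fin a → Fin b) → Set
  Bij {a} {b} π = (∀ i j → π i ≡ π j → i ≡ j) × (∀ (k : Fin b) → Σ (Fin a) λ i → π i ≡ k)

  IsUnfolding : List Rule → UTree → Set
  IsUnfolding S (node q vs ψ n π ch) =
    (Σ Form λ ρ → (rule q ρ ∈ S) × (ψ ≡ inst ρ vs))
    × Bij π
    × (∀ i → atomOf (ch (π i)) ≡ occAtom ψ i)
    × (∀ j → IsUnfolding S (ch j))

  UnfoldingTreeOf : List Rule → Atom → UTree → Set
  UnfoldingTreeOf S a u = (atomOf u ≡ a) × IsUnfolding S u

  χ : UTree → Form
  χ (node q vs ψ n π ch) = replace ψ (λ i → χ (ch (π i)))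

  SatS : List Rule → Store → Heap → Form → Set
  SatS S s h φ = Σ (Fin (occ φ) → UTree) λ us →
    (∀ i → UnfoldingTreeOf S (occAtom φ i) (us i)) × Sat s h (replace φ (χ ∘ us))

  Pos : UTree → Set
  Pos (node _ _ _ n _ ch) = ⊤ ⊎ Σ (Fin n) λ j → Pos (ch j)

  root : (u : UTree) → Pos u
  root (node _ _ _ _ _ _) = inj₁ tt

  nChildren : (u : UTree) → Pos u → ℕ
  nChildren (node _ _ _ n _ ch) (inj₁ _)       = n
  nChildren (node _ _ _ n _ ch) (inj₂ (j , w)) = nChildren (ch j) w

  child : (u : UTree) (w : Pos u) → Fin (nChildren u w) → Pos u
  child (node _ _ _ n _ ch) (inj₁ _)       j = inj₂ (j , root (ch j))
  child (node _ _ _ n _ ch) (inj₂ (k , w)) j = inj₂ (k , child (ch k) w j)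

  Embedding : UTree → Heap → Set
  Embedding u h = Σ (Pos u → Loc) λ Λ →
      (∀ w w′ → Λ w ≡ Λ w′ → w ≡ w′)
    × (∀ w → Σ (Vec Loc κ) λ v → h (Λ w) ≡ just v)
    × (∀ ℓ v → h ℓ ≡ just v → Σ (Pos u) λ w → Λ w ≡ ℓ)
    × (∀ w j → Σ (Vec Loc κ) λ v → (h (Λ w) ≡ just v)
                 × (Σ (Fin κ) λ k → lookup v k ≡ Λ (child u w j)))

-- The unfolding tree u witnessing (s , h) ⊨_S p(t₁,…,t_#p) itself embeds into h.
-- By induction on u: since the rules are progressing, a model of χ(u) consists
-- of the single cell at the root location, stored at x₁, plus a disjoint family
-- of models of the characteristic formulas of the children. Connectivity puts
-- the root location of each child among the fields of that cell, so the
-- embeddings of the children glue under the root into an embedding of u.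
module Submission where

open import Defs
open import Data.Nat using (ℕ; zero; suc; _+_; _≤_)
open import Data.Nat.Properties using (+-identityʳ; +-suc; _≟_)
open import Data.Fin using (Fin; zero; splitAt; join; _↑ˡ_; _↑ʳ_)
open import Data.Fin.Properties using (join-splitAt; splitAt-join)
open import Data.Vec using (Vec; _∷_; lookup) renaming (map to vmap; head to vhead)
open import Data.Vec.Properties using (lookup-map)
open import Data.List using (List)
open import Data.List.Relation.Unary.All using () renaming (lookup to All-lookup)
open import Data.Maybe using (just; nothing)
open import Data.Product using (Σ; ∃; _×_; _,_; proj₁; proj₂)
open import Data.Sum using (_⊎_; inj₁; inj₂; [_,_])
open import Data.Sum.Properties using ([,]-∘)
open import Data.Unit using (tt)
open import Data.Empty using (⊥; ⊥-elim)
open import Function using (_∘_)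
open import Relation.Nullary using (yes; no)
open import Relation.Binary.PropositionalEquality as ≡ using (_≡_; _≢_; refl; sym; trans; cong)

module TreeEmbedding (κ : ℕ) (ar : ℕ → ℕ) where
  open SL κ ar

  private variable
    I J : Set
    h h₁ h₂ : Heap
    ℓ : Loc
    v v′ c : Vec Loc κ

  headOf : Atom → Term
  headOf (_ , vs) = vhead vs

  nothing≢just : ∀ {A : Set} {x : A} → nothing ≢ just x
  nothing≢just ()

  split-⊇ˡ : Split h h₁ h₂ → h₁ ℓ ≡ just v → h ℓ ≡ just v
  split-⊇ˡ {ℓ = ℓ} sp e with sp ℓ
  ... | inj₁ (h₁ℓ≡nothing , _) = ⊥-elim (nothing≢just (trans (sym h₁ℓ≡nothing) e))
  ... | inj₂ (_ , hℓ≡h₁ℓ)      = trans hℓ≡h₁ℓ e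

  split-⊇ʳ : Split h h₁ h₂ → h₂ ℓ ≡ just v → h ℓ ≡ just v
  split-⊇ʳ {ℓ = ℓ} sp e with sp ℓ
  ... | inj₁ (_ , hℓ≡h₂ℓ)      = trans hℓ≡h₂ℓ e
  ... | inj₂ (h₂ℓ≡nothing , _) = ⊥-elim (nothing≢just (trans (sym h₂ℓ≡nothing) e))

  split-disjoint : Split h h₁ h₂ → h₁ ℓ ≡ just v → h₂ ℓ ≡ just v′ → ⊥
  split-disjoint {ℓ = ℓ} sp e e′ with sp ℓ
  ... | inj₁ (h₁ℓ≡nothing , _) = nothing≢just (trans (sym h₁ℓ≡nothing) e)
  ... | inj₂ (h₂ℓ≡nothing , _) = nothing≢just (trans (sym h₂ℓ≡nothing) e′)

  ⟦shiftT-1⟧ : ∀ ℓ s t → ⟦ shiftT 1 t ⟧ (ℓ ∷ₛ s) ≡ ⟦ t ⟧ s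
  ⟦shiftT-1⟧ ℓ s (var k) = refl
  ⟦shiftT-1⟧ ℓ s nil     = refl

  ⟦substT-lift-shiftT⟧ : ∀ σ d ℓ s t →
    ⟦ substT (lift σ) (shiftT (suc d) t) ⟧ (ℓ ∷ₛ s) ≡ ⟦ substT σ (shiftT d t) ⟧ s
  ⟦substT-lift-shiftT⟧ σ d ℓ s (var k) = ⟦shiftT-1⟧ ℓ s (σ (d + k))
  ⟦substT-lift-shiftT⟧ σ d ℓ s nil     = refl

  shiftT-zero : ∀ t → shiftT 0 t ≡ t
  shiftT-zero (var k) = refl
  shiftT-zero nil     = refl

  record Decomposition (I : Set) (atoms : I → Atom) (g : I → Form) (h : Heap) (c : Vec Loc κ) : Set where
    field
      store      : I → Store
      heap       : I → Heap
      sat        : ∀ i → Sat (store i) (heap i) (g i)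
      disjoint   : ∀ {i i′ ℓ v v′} → heap i ℓ ≡ just v → heap i′ ℓ ≡ just v′ → i ≡ i′
      heap-⊆     : ∀ i {ℓ v} → heap i ℓ ≡ just v → h ℓ ≡ just v
      covers     : ∀ {ℓ v} → h ℓ ≡ just v → Σ I λ i → heap i ℓ ≡ just v
      headInCell : ∀ i → ∃ λ k → ⟦ headOf (atoms i) ⟧ (store i) ≡ lookup c k

  reindex : {atoms : I → Atom} {g : I → Form} {atoms′ : J → Atom} {g′ : J → Form}
    (f : J → I) (f⁻¹ : I → J) → (∀ i → f (f⁻¹ i) ≡ i) → (∀ j → f⁻¹ (f j) ≡ j) →
    (∀ j → atoms (f j) ≡ atoms′ j) → (∀ j → g (f j) ≡ g′ j) →
    Decomposition I atoms g h c → Decomposition J atoms′ g′ h c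
  reindex {h = h} {c = c} {atoms = atoms} f f⁻¹ f∘f⁻¹ f⁻¹∘f atoms≡ g≡ D = record
    { store      = store ∘ f
    ; heap       = heap ∘ f
    ; sat        = λ j → ≡.subst (Sat _ _) (g≡ j) (sat (f j))
    ; disjoint   = disjoint′
    ; heap-⊆     = heap-⊆ ∘ f
    ; covers     = covers′
    ; headInCell = λ j → ≡.subst (λ a → ∃ λ k → ⟦ headOf a ⟧ (store (f j)) ≡ lookup c k)
                                 (atoms≡ j) (headInCell (f j))
    }
    where
    open Decomposition D
    disjoint′ : ∀ {j j′ ℓ v v′} → heap (f j) ℓ ≡ just v → heap (f j′) ℓ ≡ just v′ → j ≡ j′
    disjoint′ {j} {j′} e e′ = trans (sym (f⁻¹∘f j)) (trans (cong f⁻¹ (disjoint e e′)) (f⁻¹∘f j′))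
    covers′ : ∀ {ℓ v} → h ℓ ≡ just v → Σ _ λ j → heap (f j) ℓ ≡ just v
    covers′ {ℓ} {v} e with covers e
    ... | i , e′ = f⁻¹ i , ≡.subst (λ x → heap x ℓ ≡ just v) (sym (f∘f⁻¹ i)) e′

  decomposition-⊎ : {atoms₁ : I → Atom} {g₁ : I → Form} {atoms₂ : J → Atom} {g₂ : J → Form} →
    Split h h₁ h₂ → Decomposition I atoms₁ g₁ h₁ c → Decomposition J atoms₂ g₂ h₂ c →
    Decomposition (I ⊎ J) [ atoms₁ , atoms₂ ] [ g₁ , g₂ ] h c
  decomposition-⊎ {I = I} {J = J} {h = h} sp D₁ D₂ = record
    { store      = [ D₁.store , D₂.store ]
    ; heap       = heap
    ; sat        = λ { (inj₁ i) → D₁.sat i ; (inj₂ j) → D₂.sat j }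
    ; disjoint   = disjoint
    ; heap-⊆     = λ { (inj₁ i) → split-⊇ˡ sp ∘ D₁.heap-⊆ i ; (inj₂ j) → split-⊇ʳ sp ∘ D₂.heap-⊆ j }
    ; covers     = covers
    ; headInCell = λ { (inj₁ i) → D₁.headInCell i ; (inj₂ j) → D₂.headInCell j }
    }
    where
    module D₁ = Decomposition D₁
    module D₂ = Decomposition D₂
    heap : I ⊎ J → Heap
    heap = [ D₁.heap , D₂.heap ]
    disjoint : ∀ {i i′ ℓ v v′} → heap i ℓ ≡ just v → heap i′ ℓ ≡ just v′ → i ≡ i′
    disjoint {inj₁ i} {inj₁ i′} e e′ = cong inj₁ (D₁.disjoint e e′)
    disjoint {inj₂ j} {inj₂ j′} e e′ = cong inj₂ (D₂.disjoint e e′)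
    disjoint {inj₁ i} {inj₂ j}  e e′ = ⊥-elim (split-disjoint sp (D₁.heap-⊆ i e) (D₂.heap-⊆ j e′))
    disjoint {inj₂ j} {inj₁ i}  e e′ = ⊥-elim (split-disjoint sp (D₁.heap-⊆ i e′) (D₂.heap-⊆ j e))
    covers : ∀ {ℓ v} → h ℓ ≡ just v → Σ (I ⊎ J) λ i → heap i ℓ ≡ just v
    covers {ℓ} e with sp ℓ
    ... | inj₁ (_ , hℓ≡h₂ℓ) with D₂.covers (trans (sym hℓ≡h₂ℓ) e)
    ...   | j , e′ = inj₂ j , e′
    covers {ℓ} e | inj₂ (_ , hℓ≡h₁ℓ) with D₁.covers (trans (sym hℓ≡h₁ℓ) e)
    ...   | i , e′ = inj₁ i , e′

  decomposition-join : ∀ {a b} {atoms₁ : Fin a → Atom} {atoms₂ : Fin b → Atom} {g : Fin (a + b) → Form} →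
    Split h h₁ h₂ → Decomposition (Fin a) atoms₁ (g ∘ (_↑ˡ b)) h₁ c →
    Decomposition (Fin b) atoms₂ (g ∘ (a ↑ʳ_)) h₂ c →
    Decomposition (Fin (a + b)) (λ i → [ atoms₁ , atoms₂ ] (splitAt a i)) g h c
  decomposition-join {a = a} {b} {g = g} sp D₁ D₂ =
    reindex (splitAt a) (join a b) (splitAt-join a b) (join-splitAt a b) (λ _ → refl)
      (λ i → trans (sym ([,]-∘ g (splitAt a i))) (cong g (join-splitAt a b i)))
      (decomposition-⊎ sp D₁ D₂)

  decomposition-emp : {atoms : Fin 0 → Atom} {g : Fin 0 → Form} →
    Emp h → Decomposition (Fin 0) atoms g h c
  decomposition-emp emp = record
    { store = λ () ; heap = λ () ; sat = λ () ; disjoint = λ {} ; heap-⊆ = λ ()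
    ; covers = λ e → ⊥-elim (nothing≢just (trans (sym (emp _)) e)) ; headInCell = λ () }

  HeadAmong : Vec Term κ → ℕ → (q : ℕ) → Vec Term (# q) → Set
  HeadAmong ys d q vs = Σ (Fin κ) λ i → vhead vs ≡ shiftT d (lookup ys i)

  -- d is the number of binders of the rule body already opened; the fields ys
  -- live outside them.
  decompose : ∀ ys φ {d σ s h c g} →
    (∀ k → ⟦ substT σ (shiftT d (lookup ys k)) ⟧ s ≡ lookup c k) →
    NoPto φ → AllPA (HeadAmong ys) d φ → Sat s h (replace (subst σ φ) g) →
    Decomposition (Fin (occ (subst σ φ))) (occAtom (subst σ φ)) g h c
  decompose _ (pto _ _) _ ()
  decompose _ (pa q (t ∷ ts)) {σ = σ} {s} {h} fields _ (k , head≡) sat = record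
    { store      = λ _ → s
    ; heap       = λ _ → h
    ; sat        = λ { zero → sat }
    ; disjoint   = λ { {zero} {zero} _ _ → refl }
    ; heap-⊆     = λ _ e → e
    ; covers     = λ e → zero , e
    ; headInCell = λ _ → k , trans (cong (λ x → ⟦ substT σ x ⟧ s) head≡) (fields k)
    }
  decompose _ (eq _ _)  _ _ _ (emp , _) = decomposition-emp emp
  decompose _ (neq _ _) _ _ _ (emp , _) = decomposition-emp emp
  decompose ys (φ ⋆ ψ) fields (noPtoφ , noPtoψ) (headsφ , headsψ) (_ , _ , sp , satφ , satψ) =
    decomposition-join sp (decompose ys φ fields noPtoφ headsφ satφ)
                          (decompose ys ψ fields noPtoψ headsψ satψ)
  decompose ys (ex φ) {d} {σ} {s} fields noPto heads (ℓ , sat) =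
    decompose ys φ (λ k → trans (⟦substT-lift-shiftT⟧ σ d ℓ s (lookup ys k)) (fields k)) noPto heads sat

  DenotesUnder : ℕ → (ℕ → Term) → Store → Term → Loc → Set
  DenotesUnder zero    σ s t ℓ = ⟦ substT σ t ⟧ s ≡ ℓ
  DenotesUnder (suc m) σ s t ℓ = ∀ ℓ′ → DenotesUnder m (lift σ) (ℓ′ ∷ₛ s) t ℓ

  var-denotesUnder : ∀ m σ s k → DenotesUnder m σ s (var (k + m)) (⟦ σ k ⟧ s)
  var-denotesUnder zero    σ s k = cong (λ x → ⟦ σ x ⟧ s) (+-identityʳ k)
  var-denotesUnder (suc m) σ s k ℓ =
    ≡.subst₂ (λ x ℓ′ → DenotesUnder m (lift σ) (ℓ ∷ₛ s) (var x) ℓ′) (sym (+-suc k m)) (⟦shiftT-1⟧ ℓ s (σ k))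
      (var-denotesUnder m (lift σ) (ℓ ∷ₛ s) (suc k))

  record CellDecomposition (I : Set) (atoms : I → Atom) (g : I → Form) (h : Heap) (R : Loc) : Set where
    field
      cell      : Vec Loc κ
      cellHeap  : Heap
      rest      : Heap
      split     : Split h cellHeap rest
      cell-at-R : cellHeap R ≡ just cell
      only-R    : ∀ ℓ → ℓ ≢ R → cellHeap ℓ ≡ nothing
      children  : Decomposition I atoms g rest cell

  decompose-body : ∀ m {t₀ ys ψ σ s h R g} → NoPto ψ → AllPA (HeadAmong ys) 0 ψ →
    DenotesUnder m σ s t₀ R → Sat s h (replace (subst σ (exs m (pto t₀ ys ⋆ ψ))) g) →
    CellDecomposition (Fin (occ (subst σ (exs m (pto t₀ ys ⋆ ψ)))))
                      (occAtom (subst σ (exs m (pto t₀ ys ⋆ ψ)))) g h R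
  decompose-body zero {ys = ys} {ψ} {σ} {s} noPto heads t₀↦R (h₁ , h₂ , sp , (cell , only) , sat) = record
    { cell      = cell′
    ; cellHeap  = h₁
    ; rest      = h₂
    ; split     = sp
    ; cell-at-R = ≡.subst (λ r → h₁ r ≡ just cell′) t₀↦R cell
    ; only-R    = λ ℓ ℓ≢R → only ℓ (λ ℓ≡t₀ → ℓ≢R (trans ℓ≡t₀ t₀↦R))
    ; children  = decompose ys ψ fields noPto heads sat
    }
    where
    ⟦_⟧ₛ : Term → Loc
    ⟦ t ⟧ₛ = ⟦ substT σ t ⟧ s
    cell′ : Vec Loc κ
    cell′ = vmap (λ u → ⟦ u ⟧ s) (vmap (substT σ) ys)
    fields : ∀ k → ⟦ shiftT 0 (lookup ys k) ⟧ₛ ≡ lookup cell′ k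
    fields k = begin
      ⟦ shiftT 0 (lookup ys k) ⟧ₛ                              ≡⟨ cong ⟦_⟧ₛ (shiftT-zero (lookup ys k)) ⟩
      ⟦ lookup ys k ⟧ₛ                                         ≡⟨ cong (λ u → ⟦ u ⟧ s) (lookup-map k (substT σ) ys) ⟨
      ⟦ lookup (vmap (substT σ) ys) k ⟧ s                      ≡⟨ lookup-map k (λ u → ⟦ u ⟧ s) (vmap (substT σ) ys) ⟨
      lookup cell′ k                                           ∎
      where open ≡.≡-Reasoning
  decompose-body (suc m) {ys = ys} noPto heads t₀↦R (ℓ , sat) =
    decompose-body m {ys = ys} noPto heads (t₀↦R ℓ) sat

  record RootedEmbedding (u : UTree) (h : Heap) (R : Loc) : Set where
    field
      Λ            : Pos u → Loc
      injective    : ∀ w w′ → Λ w ≡ Λ w′ → w ≡ w′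
      inDom        : ∀ w → ∃ λ v → h (Λ w) ≡ just v
      onto         : ∀ ℓ v → h ℓ ≡ just v → Σ (Pos u) λ w → Λ w ≡ ℓ
      childInField : ∀ w j → ∃ λ v → h (Λ w) ≡ just v × ∃ λ k → lookup v k ≡ Λ (child u w j)
      Λ-root       : Λ (root u) ≡ R

  toEmbedding : ∀ {u h R} → RootedEmbedding u h R → Embedding u h
  toEmbedding E = Λ , injective , inDom , onto , childInField
    where open RootedEmbedding E

  SubtreeEmbeddings : ∀ {n atoms g h c} → (Fin n → UTree) → Decomposition (Fin n) atoms g h c → Set
  SubtreeEmbeddings ch D = ∀ j → RootedEmbedding (ch j) (heap j) (⟦ headOf (atomOf (ch j)) ⟧ (store j))
    where open Decomposition D

  embed-node : ∀ {q vs ψ n π} {ch : Fin n → UTree} {h R} →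
    (C : CellDecomposition (Fin n) (atomOf ∘ ch) (χ ∘ ch) h R) →
    SubtreeEmbeddings ch (CellDecomposition.children C) →
    RootedEmbedding (node q vs ψ n π ch) h R
  embed-node {q} {vs} {ψ} {n} {π} {ch} {h} {R} C E = record
    { Λ = Λ ; injective = injective ; inDom = inDom ; onto = onto
    ; childInField = childInField ; Λ-root = refl }
    where
    open CellDecomposition C
    open Decomposition children
    module E j = RootedEmbedding (E j)
    u : UTree
    u = node q vs ψ n π ch
    Λ : Pos u → Loc
    Λ (inj₁ _)       = R
    Λ (inj₂ (j , w)) = E.Λ j w
    child-⊆ : ∀ j {ℓ v} → heap j ℓ ≡ just v → h ℓ ≡ just v
    child-⊆ j = split-⊇ʳ split ∘ heap-⊆ j
    inDom : ∀ w → ∃ λ v → h (Λ w) ≡ just v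
    inDom (inj₁ _)       = cell , split-⊇ˡ split cell-at-R
    inDom (inj₂ (j , w)) = proj₁ (E.inDom j w) , child-⊆ j (proj₂ (E.inDom j w))
    R≢child : ∀ j w → R ≢ E.Λ j w
    R≢child j w R≡Λw with E.inDom j w
    ... | v , e = split-disjoint split cell-at-R (heap-⊆ j (≡.subst (λ ℓ → heap j ℓ ≡ just v) (sym R≡Λw) e))
    injective : ∀ w w′ → Λ w ≡ Λ w′ → w ≡ w′
    injective (inj₁ _)       (inj₁ _)         _ = refl
    injective (inj₁ _)       (inj₂ (j , w))   e = ⊥-elim (R≢child j w e)
    injective (inj₂ (j , w)) (inj₁ _)         e = ⊥-elim (R≢child j w (sym e))
    injective (inj₂ (j , w)) (inj₂ (j′ , w′)) e with E.inDom j w | E.inDom j′ w′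
    ... | v , ev | v′ , ev′ with disjoint (≡.subst (λ ℓ → heap j ℓ ≡ just v) e ev) ev′
    ... | refl = cong (λ x → inj₂ (j , x)) (E.injective j w w′ e)
    onto : ∀ ℓ v → h ℓ ≡ just v → Σ (Pos u) λ w → Λ w ≡ ℓ
    onto ℓ v e with split ℓ
    ... | inj₁ (_ , hℓ≡restℓ) with covers (trans (sym hℓ≡restℓ) e)
    ...   | j , e′ with E.onto j ℓ v e′
    ...     | w , Λw≡ℓ = inj₂ (j , w) , Λw≡ℓ
    onto ℓ v e | inj₂ (_ , hℓ≡cellHeapℓ) with ℓ ≟ R
    ... | yes ℓ≡R = inj₁ tt , sym ℓ≡R
    ... | no ℓ≢R  = ⊥-elim (nothing≢just (trans (sym (only-R ℓ ℓ≢R)) (trans (sym hℓ≡cellHeapℓ) e)))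
    childInField : ∀ w j → ∃ λ v → h (Λ w) ≡ just v × ∃ λ k → lookup v k ≡ Λ (child u w j)
    childInField (inj₁ _) j with headInCell j
    ... | k , head≡ = cell , split-⊇ˡ split cell-at-R , k , sym (trans (E.Λ-root j) head≡)
    childInField (inj₂ (j , w)) i with E.childInField j w i
    ... | v , e , inField = v , child-⊆ j e , inField

  module _ {S : List Rule} (pc : ProgressingConnected S) where
    rootedEmbedding : ∀ u → IsUnfolding S u → ∀ {s h} → Sat s h (χ u) →
      RootedEmbedding u h (⟦ headOf (atomOf u) ⟧ s)
    rootedEmbedding (node q (v ∷ vs) ψ n π ch)
                    ((ρ , ρ∈S , refl) , (π-injective , π-surjective) , atoms≡ , unfolds) {s} sat
      with All-lookup pc ρ∈S
    ... | m , ys , ψ₀ , refl , noPto , heads =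
      embed-node C λ j → rootedEmbedding (ch j) (unfolds j) (Decomposition.sat (CellDecomposition.children C) j)
      where
      π⁻¹ : Fin n → Fin (occ ψ)
      π⁻¹ = proj₁ ∘ π-surjective
      π∘π⁻¹ : ∀ j → π (π⁻¹ j) ≡ j
      π∘π⁻¹ = proj₂ ∘ π-surjective
      π⁻¹∘π : ∀ i → π⁻¹ (π i) ≡ i
      π⁻¹∘π i = π-injective _ _ (π∘π⁻¹ (π i))
      -- Under the m binders of the body, x₁ is var m.
      module C′ = CellDecomposition
        (decompose-body m noPto heads (var-denotesUnder m (vecSub (v ∷ vs)) s 0) sat)
      C : CellDecomposition (Fin n) (atomOf ∘ ch) (χ ∘ ch) _ (⟦ v ⟧ s)
      C = record
        { cell      = C′.cell
        ; cellHeap  = C′.cellHeap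
        ; rest      = C′.rest
        ; split     = C′.split
        ; cell-at-R = C′.cell-at-R
        ; only-R    = C′.only-R
        ; children  = reindex π⁻¹ π π⁻¹∘π π∘π⁻¹
            (λ j → trans (sym (atoms≡ (π⁻¹ j))) (cong (atomOf ∘ ch) (π∘π⁻¹ j)))
            (λ j → cong (χ ∘ ch) (π∘π⁻¹ j))
            C′.children }

lemma1 : (κ : ℕ) → 1 ≤ κ → (ar : ℕ → ℕ) →
    let open SL κ ar in
    (S : List Rule) → WFRules S → ProgressingConnected S →
    (p : ℕ) (ts : Vec Term (# p)) (s : Store) (h : Heap) → IsHeap h →
    SatS S s h (pa p ts) →
    Σ UTree (λ u → UnfoldingTreeOf S (p , ts) u × Sat s h (χ u) × Embedding u h)
lemma1 κ _ ar S _ pc p ts s h _ (us , unfoldings , sat) =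
  us zero , unfoldings zero , sat ,
  toEmbedding (rootedEmbedding pc (us zero) (proj₂ (unfoldings zero)) sat)
  where open TreeEmbedding κ ar
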